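{- Let $k\geq 4$ and let $\xi$, $\mathbf{u}=\xi^\omega(0)$ be as in the context. Then: (1) for each integer $n\geq 1$ with $n\neq k$, the factor $w=\xi^n(0)$ has the synchronizing points $(\varepsilon,w)$ and $(w,\varepsilon)$; (2) for each $n\leq k$, the shortest return word to $\xi^n(0)$ in $\mathbf{u}$ is $\xi^n(0)$; (3) every occurrence of $\xi^k(0)\xi^k(0)$ in $\mathbf{u}$ is followed by the letter $0'$.
   Context: Fix an integer $k\geq 4$. Let $\mathcal{A}=\{0,1,\ldots,k-1,0',1',\ldots,(k-1)'\}$. Let $\xi:\mathcal{A}^*\to\mathcal{A}^*$ be the morphism given by $\xi(0)=01$, $\xi(j)=j+1$ for $1\leq j\leq k-2$, $\xi(k-1)=0'$, and $\xi(0')=0'1'$, $\xi(j')=(j+1)'$ for $1\leq j\leq k-2$, $\xi((k-1)')=0$. Let $\mathbf{u}=\xi^\omega(0)$ be the infinite fixed point of $\xi$ starting with $0$, and $\mathcal{L}(\mathbf{u})$ its set of factors. For a factor $w$ of $\mathbf{u}$ (note $\xi(\mathbf{u})=\mathbf{u}$), a pair $(w_1,w_2)$ with $w=w_1w_2$ is a synchronizing point of $w$ if for all $p,s\in\mathcal{L}(\mathbf{u})$ and $v\in\mathcal{L}(\mathbf{u})$ with $\xi(v)=pws$ there is a factorization $v=v_1v_2$ with $\xi(v_1)=pw_1$ and $\xi(v_2)=w_2s$. If $j<\ell$ are two consecutive occurrences (starting positions) of $w$ in $\mathbf{u}=u_0u_1\cdots$, the word $u_j\cdots u_{\ell-1}$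 is a return word to $w$. -}

module Defs where

open import Data.Nat using (ℕ; zero; suc; _+_; _∸_; _≤_; _<_; z≤n; s≤s)
open import Data.Nat.Properties using (≤-trans; _<?_)
open import Data.Fin using (Fin; toℕ; fromℕ<)
open import Data.Bool using (Bool; true; false; not)
open import Data.List using (List; []; _∷_; _++_; length; concatMap)
open import Data.Maybe using (Maybe; just; nothing; fromMaybe)
open import Data.Product using (_×_; _,_; ∃; ∃-syntax)
open import Data.Unit using (⊤)
open import Relation.Nullary using (¬_; yes; no)
open import Relation.Binary.PropositionalEquality using (_≡_)

module Setup (k : ℕ) (hk : 4 ≤ k) where

  -- A letter (b , j): j ∈ {0,…,k-1}; b = false means unprimed j, b = true means j'.
  Letter : Set
  Letter = Bool × Fin k

  Word : Set
  Word = List Letter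

  fzero : Fin k
  fzero = fromℕ< (≤-trans (s≤s z≤n) hk)

  𝟘 : Letter
  𝟘 = (false , fzero)

  𝟘′ : Letter
  𝟘′ = (true , fzero)

  -- ξ on letters: ξ(0)=01, ξ(j)=j+1 (1 ≤ j ≤ k-2), ξ(k-1)=0', and the same
  -- with primes swapped (ξ(0')=0'1', ξ(j')=(j+1)', ξ((k-1)')=0).
  ξ-letter : Letter → Word
  ξ-letter (b , j) with suc (toℕ j) <? k
  ... | no _ = (not b , fzero) ∷ []
  ... | yes p with toℕ j
  ...   | zero  = (b , fzero) ∷ (b , fromℕ< p) ∷ []
  ...   | suc _ = (b , fromℕ< p) ∷ []

  ξ : Word → Word
  ξ = concatMap ξ-letter

  ξ^ : ℕ → Word → Word
  ξ^ zero    w = w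
  ξ^ (suc n) w = ξ (ξ^ n w)

  at : Word → ℕ → Maybe Letter
  at []      _       = nothing
  at (a ∷ w) zero    = just a
  at (a ∷ w) (suc i) = at w i

  -- The fixed point u = ξ^ω(0): its i-th letter is the i-th letter of ξ^(i+1)(0)
  -- (ξ^n(0) is a prefix of ξ^(n+1)(0) and has length ≥ n+1, so the default
  -- value is never used).
  u : ℕ → Letter
  u i = fromMaybe 𝟘 (at (ξ^ (suc i) (𝟘 ∷ [])) i)

  OccursAt : Word → ℕ → Set
  OccursAt []      i = ⊤
  OccursAt (a ∷ w) i = (u i ≡ a) × OccursAt w (suc i)

  Factor : Word → Set
  Factor w = ∃[ i ] OccursAt w i

  slice : ℕ → ℕ → Word
  slice i zero    = []
  slice i (suc n) = u i ∷ slice (suc i) n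

  SyncPoint : Word → Word → Set
  SyncPoint w₁ w₂ =
    ∀ (p s v : Word) → Factor p → Factor s → Factor v →
    ξ v ≡ p ++ (w₁ ++ w₂) ++ s →
    ∃[ v₁ ] ∃[ v₂ ] (v ≡ v₁ ++ v₂) × (ξ v₁ ≡ p ++ w₁) × (ξ v₂ ≡ w₂ ++ s)

  ReturnWord : Word → Word → Set
  ReturnWord w r =
    ∃[ j ] ∃[ ℓ ] (j < ℓ) × OccursAt w j × OccursAt w ℓ ×
      (∀ m → j < m → m < ℓ → ¬ OccursAt w m) × (r ≡ slice j (ℓ ∸ j))

  ShortestReturnWord : Word → Word → Set
  ShortestReturnWord w r = ReturnWord w r × (∀ r′ → ReturnWord w r′ → length r ≤ length r′)

-- Write 0, 1, … for letters of either prime and x̄ for x with its prime swapped. Let K = k − 1 and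
-- ρ = ξᴷ on letters: ρ(0) = 0 1 ⋯ (k−1) and ρ(j) = 0̄ 1̄ ⋯ (j−1)̄ for j ≥ 1. So ρ is injective and each ρ(a)
-- starts with the only 0 it contains: ρ* = ξᴷ is a marked code, and u = ρ*(u). Hence a factor ρ*(P) 0 R
-- of u lifts to a factor P Y of u with ρ*(Y) beginning with 0 R. Every factor of u is made of runs
-- 0 1 2 ⋯ and avoids 000, 100 and 1010, because ξ preserves these local rules.
-- (1) A cut of ξ(v) that is not between images of letters lies inside some ξ(0) = 0 1. Now ξⁿ(0) starts
-- with 0, and for 1 ≤ n ≠ k it ends either with a nonzero letter or as ρ*(⋯ 0 0) 0. Lifting the latter
-- together with a following 1 gives 0 0 y ⋯ in u with ρ*(y ⋯) = 0 1 ⋯; but y is a 1 (no 000) and ρ(1)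
-- is a single 0, so the letter after it is a 0, not a 1.
-- (2) For n ≤ k, ξⁿ(0) = 0 T with no unprimed 0 in T, so two occurrences cannot overlap; and
-- ξⁿ(0)ξⁿ(0) = ξⁿ(00) is a factor because 00 is.
-- (3) ξᵏ(0) = ρ(0) 0′, so ξᵏ(0)ξᵏ(0)x = ρ*(0 1 0) 0′ x. Lifting, 0 1 0 is followed in u by 1 2 (local
-- rules), and ρ(1 2) = 0′ 0′1′ forces x = 0′.
{-# OPTIONS --safe #-}
module Submission where

open import Defs
open import Data.Nat using (ℕ; zero; suc; _+_; _*_; _∸_; _≤_; _<_; z≤n; s≤s; NonZero; >-nonZero)
open import Data.Nat.DivMod using (_%_; _/_; m%n<n; m≡m%n+[m/n]*n)
open import Data.Nat.Properties
open import Data.Fin using (toℕ; fromℕ<)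
open import Data.Fin.Properties using (toℕ-fromℕ<; toℕ-injective; toℕ<n)
open import Data.Bool using (Bool; false; not)
open import Data.Bool.Properties using (not-injective)
open import Data.List using (List; []; _∷_; _++_; length; concatMap)
open import Data.List.Properties using (++-assoc; length-++; ++-identityʳ; ++-cancelˡ; ∷-injective; ∷-injectiveˡ; ∷-injectiveʳ; ∷ʳ-injectiveʳ; concatMap-++)
open import Data.List.Relation.Unary.All as All using (All; []; _∷_)
open import Data.List.Relation.Unary.All.Properties using (++⁺; ++⁻ʳ)
open import Data.Maybe using (just)
open import Data.Maybe.Properties using (just-injective)
open import Data.Product using (_×_; _,_; ∃-syntax; proj₁; proj₂)
open import Data.Sum using (_⊎_; inj₁; inj₂)
open import Data.Unit using (⊤; tt)
open import Data.Empty using (⊥; ⊥-elim)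
open import Function using (_∘_)
open import Relation.Nullary using (¬_; yes; no)
open import Relation.Binary.PropositionalEquality

module _ {A : Set} where

  ++-≡-++ : ∀ (X S P C : List A) → X ++ S ≡ P ++ C →
    (∃[ D ] (P ≡ X ++ D × S ≡ D ++ C)) ⊎ (∃[ d ] ∃[ D ] (X ≡ P ++ d ∷ D × C ≡ d ∷ D ++ S))
  ++-≡-++ []      S P       C e = inj₁ (P , refl , e)
  ++-≡-++ (x ∷ X) S []      C e = inj₂ (x , X , refl , sym e)
  ++-≡-++ (x ∷ X) S (p ∷ P) C e with ∷-injective e
  ... | refl , e′ with ++-≡-++ X S P C e′
  ...   | inj₁ (D , refl , e₂) = inj₁ (D , refl , e₂)
  ...   | inj₂ (d , D , refl , e₂) = inj₂ (d , D , refl , e₂)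

  []≢∷ : ∀ {x : A} {S} → _≢_ {A = List A} [] (x ∷ S)
  []≢∷ ()

  singleton-≡-++-∷ : ∀ (x : A) {y : A} P S → x ∷ [] ≡ P ++ y ∷ S → P ≡ [] × x ≡ y × S ≡ []
  singleton-≡-++-∷ x []          S refl = refl , refl , refl
  singleton-≡-++-∷ x (_ ∷ [])    S ()
  singleton-≡-++-∷ x (_ ∷ _ ∷ _) S ()

module _ {A B : Set} (f : A → List B) where

  concatMap-cut : ∀ (v : List A) (P S : List B) → concatMap f v ≡ P ++ S →
    (∃[ v₁ ] ∃[ v₂ ] (v ≡ v₁ ++ v₂ × concatMap f v₁ ≡ P × concatMap f v₂ ≡ S))
    ⊎ (∃[ a ] ∃[ v₁ ] ∃[ v₂ ] ∃[ p ] ∃[ P′ ] ∃[ s ] ∃[ S′ ]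
         (f a ≡ (p ∷ P′) ++ s ∷ S′ × P ≡ concatMap f v₁ ++ p ∷ P′ × S ≡ s ∷ S′ ++ concatMap f v₂))
  concatMap-cut []      [] S e = inj₁ ([] , [] , refl , refl , e)
  concatMap-cut (a ∷ v) P  S e with ++-≡-++ (f a) (concatMap f v) P S e
  ... | inj₁ (D , refl , e′) with concatMap-cut v D S e′
  ...   | inj₁ (v₁ , v₂ , refl , refl , e₂) = inj₁ (a ∷ v₁ , v₂ , refl , refl , e₂)
  ...   | inj₂ (b , v₁ , v₂ , p , P′ , s , S′ , eb , refl , eS) =
          inj₂ (b , a ∷ v₁ , v₂ , p , P′ , s , S′ , eb , sym (++-assoc (f a) (concatMap f v₁) _) , eS)
  concatMap-cut (a ∷ v) [] S e | inj₂ (d , D , _ , _) = inj₁ ([] , a ∷ v , refl , refl , e)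
  concatMap-cut (a ∷ v) (p ∷ P) S e | inj₂ (d , D , ea , refl) =
    inj₂ (a , [] , v , p , P , d , D , ea , refl , refl)

-- Codeword boundaries in f*(Y) are exactly the positions of marked letters.
module MarkedCode {A B : Set} (Mark : B → Set) (f : A → List B)
  (f-shape : ∀ a → ∃[ c ] ∃[ T ] (f a ≡ c ∷ T × Mark c × All (¬_ ∘ Mark) T))
  (f-injective : ∀ {a a′} → f a ≡ f a′ → a ≡ a′) where

  MarkedHead : List B → Set
  MarkedHead []      = ⊤
  MarkedHead (c ∷ _) = Mark c

  MarkedHead-++ : ∀ (X R : List B) → MarkedHead X → MarkedHead R → MarkedHead (X ++ R)
  MarkedHead-++ []      R _  mR = mR
  MarkedHead-++ (_ ∷ _) R mX _  = mX

  MarkedHead-concatMap : ∀ (Y : List A) → MarkedHead (concatMap f Y)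
  MarkedHead-concatMap []      = tt
  MarkedHead-concatMap (y ∷ Y) with f-shape y
  ... | c , T , e , m , _ rewrite e = m

  unmarked-prefix-unique : ∀ (T T′ S S′ : List B) → All (¬_ ∘ Mark) T → All (¬_ ∘ Mark) T′ →
    MarkedHead S → MarkedHead S′ → T ++ S ≡ T′ ++ S′ → T ≡ T′
  unmarked-prefix-unique []      []       _ _ _ _ _ _ _ = refl
  unmarked-prefix-unique []      (t ∷ T′) (s ∷ S) _ _ (¬m ∷ _) m _ e =
    ⊥-elim (¬m (subst Mark (∷-injectiveˡ e) m))
  unmarked-prefix-unique (t ∷ T) []       _ (s ∷ S′) (¬m ∷ _) _ _ m e =
    ⊥-elim (¬m (subst Mark (sym (∷-injectiveˡ e)) m))
  unmarked-prefix-unique (t ∷ T) (t′ ∷ T′) S S′ (_ ∷ uT) (_ ∷ uT′) mS mS′ e =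
    cong₂ _∷_ (∷-injectiveˡ e) (unmarked-prefix-unique T T′ S S′ uT uT′ mS mS′ (∷-injectiveʳ e))

  concatMap-injective : ∀ (Y Y′ : List A) → concatMap f Y ≡ concatMap f Y′ → Y ≡ Y′
  concatMap-injective []      []       _ = refl
  concatMap-injective []      (y′ ∷ Y′) e =
    let _ , _ , ey′ , _ = f-shape y′ in ⊥-elim ([]≢∷ (trans e (cong (_++ concatMap f Y′) ey′)))
  concatMap-injective (y ∷ Y) []        e =
    let _ , _ , ey , _ = f-shape y in ⊥-elim ([]≢∷ (trans (sym e) (cong (_++ concatMap f Y) ey)))
  concatMap-injective (y ∷ Y) (y′ ∷ Y′) e with f-shape y | f-shape y′
  ... | c , T , ey , _ , uT | c′ , T′ , ey′ , _ , uT′ = cong₂ _∷_ (f-injective fy≡fy′) (concatMap-injective Y Y′ rest)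
    where
    e′ : c ∷ T ++ concatMap f Y ≡ c′ ∷ T′ ++ concatMap f Y′
    e′ = trans (cong (_++ concatMap f Y) (sym ey)) (trans e (cong (_++ concatMap f Y′) ey′))
    fy≡fy′ : f y ≡ f y′
    fy≡fy′ = trans ey (trans (cong₂ _∷_ (∷-injectiveˡ e′)
               (unmarked-prefix-unique T T′ _ _ uT uT′ (MarkedHead-concatMap Y) (MarkedHead-concatMap Y′) (∷-injectiveʳ e′)))
               (sym ey′))
    rest : concatMap f Y ≡ concatMap f Y′
    rest = ++-cancelˡ (f y) _ _ (trans e (cong (_++ concatMap f Y′) (sym fy≡fy′)))

  concatMap-split-at-mark : ∀ (Y : List A) (X C : List B) → concatMap f Y ≡ X ++ C → MarkedHead C →
    ∃[ Y₁ ] ∃[ Y₂ ] (Y ≡ Y₁ ++ Y₂ × concatMap f Y₁ ≡ X × concatMap f Y₂ ≡ C)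
  concatMap-split-at-mark Y X C e mC with concatMap-cut f Y X C e
  ... | inj₁ cut = cut
  ... | inj₂ (a , _ , _ , p , P′ , s , S′ , ea , _ , refl) with f-shape a
  ...   | c , T , ea′ , _ , uT = ⊥-elim (All.head (++⁻ʳ P′ (subst (All (¬_ ∘ Mark)) T≡ uT)) mC)
    where
    T≡ : T ≡ P′ ++ s ∷ S′
    T≡ = ∷-injectiveʳ (trans (sym ea′) ea)

  concatMap-cancel-prefix : ∀ (P Y : List A) (R : List B) → concatMap f Y ≡ concatMap f P ++ R → MarkedHead R →
    ∃[ Y₃ ] (Y ≡ P ++ Y₃ × concatMap f Y₃ ≡ R)
  concatMap-cancel-prefix P Y R e mR with concatMap-split-at-mark Y (concatMap f P) R e mR
  ... | Y₁ , Y₂ , refl , e₁ , e₂ rewrite concatMap-injective Y₁ P e₁ = Y₂ , refl , e₂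

module Proof (k : ℕ) (hk : 4 ≤ k) where
  open Setup k hk

  index : Letter → ℕ
  index = toℕ ∘ proj₂

  primed : Letter → Bool
  primed = proj₁

  Letter-≡ : ∀ {a c : Letter} → primed a ≡ primed c → index a ≡ index c → a ≡ c
  Letter-≡ {b , i} {.b , j} refl e = cong (b ,_) (toℕ-injective e)

  index<k : ∀ a → index a < k
  index<k (_ , j) = toℕ<n j

  IsZero : Letter → Set
  IsZero a = index a ≡ 0

  IsOne : Letter → Set
  IsOne a = index a ≡ 1

  Succ : Letter → Letter → Set
  Succ a c = primed c ≡ primed a × index c ≡ suc (index a)

  data ξ-View (a : Letter) : Set where
    zero-letter  : ∀ o → IsZero a → Succ a o → ξ-letter a ≡ a ∷ o ∷ [] → ξ-View a
    inner-letter : ∀ c → ¬ IsZero a → Succ a c → ξ-letter a ≡ c ∷ [] → ξ-View a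
    top-letter   : ∀ c → suc (index a) ≡ k → IsZero c → primed c ≡ not (primed a) → ξ-letter a ≡ c ∷ [] → ξ-View a

  index-fzero : toℕ fzero ≡ 0
  index-fzero = toℕ-fromℕ< _

  private
    ξ-letter-top : ∀ b j {¬p} → (suc (toℕ j) <? k) ≡ no ¬p → ξ-letter (b , j) ≡ (not b , fzero) ∷ []
    ξ-letter-top b j e rewrite e = refl

    ξ-letter-below-top : ∀ b j {p} → (suc (toℕ j) <? k) ≡ yes p →
      (IsZero (b , j) × ξ-letter (b , j) ≡ (b , fzero) ∷ (b , fromℕ< p) ∷ [])
      ⊎ (¬ IsZero (b , j) × ξ-letter (b , j) ≡ (b , fromℕ< p) ∷ [])
    ξ-letter-below-top b j e rewrite e with toℕ j
    ... | zero  = inj₁ (refl , refl)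
    ... | suc _ = inj₂ (0≢1+n ∘ sym , refl)

  ξ-view : ∀ a → ξ-View a
  ξ-view (b , j) with suc (toℕ j) <? k in eq
  ... | no ¬p = top-letter _ (≤-antisym (index<k (b , j)) (≮⇒≥ ¬p)) index-fzero refl (ξ-letter-top b j eq)
  ... | yes p with ξ-letter-below-top b j eq
  ...   | inj₁ (z , e) = zero-letter _ z (refl , toℕ-fromℕ< p)
                           (trans e (cong (λ i → (b , i) ∷ (b , fromℕ< p) ∷ []) (toℕ-injective (trans index-fzero (sym z)))))
  ...   | inj₂ (¬z , e) = inner-letter _ ¬z (refl , toℕ-fromℕ< p) e

  IsZero-𝟘 : IsZero 𝟘
  IsZero-𝟘 = index-fzero

  zero≢top : ∀ {a} → IsZero a → suc (index a) ≢ k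
  zero≢top z t with subst (4 ≤_) (trans (sym t) (cong suc z)) hk
  ... | s≤s ()

  one≢top : ∀ {a} → IsOne a → suc (index a) ≢ k
  one≢top o t with subst (4 ≤_) (trans (sym t) (cong suc o)) hk
  ... | s≤s (s≤s ())

  suc-index⇒¬IsZero : ∀ {a i} → index a ≡ suc i → ¬ IsZero a
  suc-index⇒¬IsZero ia z = 0≢1+n (trans (sym z) ia)

  Succ⇒¬IsZero : ∀ {a c} → Succ a c → ¬ IsZero c
  Succ⇒¬IsZero {c = c} (_ , i) = suc-index⇒¬IsZero {c} i

  Succ-IsZero⇒IsOne : ∀ {a c} → Succ a c → IsZero a → IsOne c
  Succ-IsZero⇒IsOne (_ , i) z = trans i (cong suc z)

  IsOne⇒¬IsZero : ∀ {a} → IsOne a → ¬ IsZero a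
  IsOne⇒¬IsZero {a} = suc-index⇒¬IsZero {a}

  ξ-letter-zero : ∀ {z} → IsZero z → ∃[ o ] (Succ z o × ξ-letter z ≡ z ∷ o ∷ [])
  ξ-letter-zero {z} iz with ξ-view z
  ... | zero-letter o _ so e    = o , so , e
  ... | inner-letter _ ¬z _ _   = ⊥-elim (¬z iz)
  ... | top-letter _ t _ _ _    = ⊥-elim (zero≢top {z} iz t)

  ξ-++ : ∀ (A B : Word) → ξ (A ++ B) ≡ ξ A ++ ξ B
  ξ-++ = concatMap-++ ξ-letter

  ξ^-++ : ∀ n (A B : Word) → ξ^ n (A ++ B) ≡ ξ^ n A ++ ξ^ n B
  ξ^-++ zero    A B = refl
  ξ^-++ (suc n) A B = trans (cong ξ (ξ^-++ n A B)) (ξ-++ (ξ^ n A) (ξ^ n B))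

  ξ^-+ : ∀ m n (X : Word) → ξ^ (m + n) X ≡ ξ^ m (ξ^ n X)
  ξ^-+ zero    n X = refl
  ξ^-+ (suc m) n X = cong ξ (ξ^-+ m n X)

  ξ^-suc : ∀ n (X : Word) → ξ^ (suc n) X ≡ ξ^ n (ξ X)
  ξ^-suc n X = trans (cong (λ m → ξ^ m X) (+-comm 1 n)) (ξ^-+ n 1 X)

  ξ^-concatMap : ∀ n (Y : Word) → ξ^ n Y ≡ concatMap (λ a → ξ^ n (a ∷ [])) Y
  ξ^-concatMap n []      = ξ^-[] n
    where
    ξ^-[] : ∀ n → ξ^ n [] ≡ []
    ξ^-[] zero    = refl
    ξ^-[] (suc n) = cong ξ (ξ^-[] n)
  ξ^-concatMap n (a ∷ Y) = trans (ξ^-++ n (a ∷ []) Y) (cong (ξ^ n (a ∷ []) ++_) (ξ^-concatMap n Y))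

  length-ξ : ∀ (X : Word) → length X ≤ length (ξ X)
  length-ξ []      = z≤n
  length-ξ (a ∷ X) with ξ-view a
  ... | zero-letter _ _ _ e    rewrite e = m≤n⇒m≤1+n (s≤s (length-ξ X))
  ... | inner-letter _ _ _ e   rewrite e = s≤s (length-ξ X)
  ... | top-letter _ _ _ _ e   rewrite e = s≤s (length-ξ X)

  length-ξ^ : ∀ n (X : Word) → length X ≤ length (ξ^ n X)
  length-ξ^ zero    X = ≤-refl
  length-ξ^ (suc n) X = ≤-trans (length-ξ^ n X) (length-ξ (ξ^ n X))

  [𝟘] : Word
  [𝟘] = 𝟘 ∷ []

  𝟙 : Letter
  𝟙 = false , fromℕ< (≤-trans (s≤s (s≤s z≤n)) hk)

  IsOne-𝟙 : IsOne 𝟙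
  IsOne-𝟙 = toℕ-fromℕ< _

  Succ-𝟘-𝟙 : Succ 𝟘 𝟙
  Succ-𝟘-𝟙 = refl , trans IsOne-𝟙 (cong suc (sym IsZero-𝟘))

  ξ-𝟘 : ξ [𝟘] ≡ 𝟘 ∷ 𝟙 ∷ []
  ξ-𝟘 with ξ-letter-zero {𝟘} IsZero-𝟘
  ... | o , (po , io) , e = trans (++-identityʳ _) (trans e (cong (λ c → 𝟘 ∷ c ∷ []) (Letter-≡ po (trans io (sym (proj₂ Succ-𝟘-𝟙))))))

  ξ^-suc-𝟘 : ∀ n → ξ^ (suc n) [𝟘] ≡ ξ^ n [𝟘] ++ ξ^ n (𝟙 ∷ [])
  ξ^-suc-𝟘 n = trans (ξ^-suc n [𝟘]) (trans (cong (ξ^ n) ξ-𝟘) (ξ^-++ n [𝟘] (𝟙 ∷ [])))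

  ξ^-𝟘-head : ∀ n → ∃[ T ] (ξ^ n [𝟘] ≡ 𝟘 ∷ T)
  ξ^-𝟘-head zero    = [] , refl
  ξ^-𝟘-head (suc n) with ξ^-𝟘-head n
  ... | T , e = T ++ ξ^ n (𝟙 ∷ []) , trans (ξ^-suc-𝟘 n) (cong (_++ ξ^ n (𝟙 ∷ [])) e)

  ξ^-prefix : ∀ d n → ∃[ E ] (ξ^ (d + n) [𝟘] ≡ ξ^ n [𝟘] ++ E)
  ξ^-prefix zero    n = [] , sym (++-identityʳ _)
  ξ^-prefix (suc d) n with ξ^-prefix d n
  ... | E , e = E ++ ξ^ (d + n) (𝟙 ∷ []) ,
        trans (ξ^-suc-𝟘 (d + n)) (trans (cong (_++ ξ^ (d + n) (𝟙 ∷ [])) e) (++-assoc (ξ^ n [𝟘]) E _))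

  n<length-ξ^ : ∀ n → n < length (ξ^ n [𝟘])
  n<length-ξ^ zero    = s≤s z≤n
  n<length-ξ^ (suc n) rewrite ξ^-suc-𝟘 n | length-++ (ξ^ n [𝟘]) {ξ^ n (𝟙 ∷ [])} =
    subst (suc n <_) (+-comm _ (length (ξ^ n [𝟘]))) (+-mono-≤ (length-ξ^ n (𝟙 ∷ [])) (n<length-ξ^ n))

  at-++ : ∀ (X E : Word) i {c} → at X i ≡ just c → at (X ++ E) i ≡ just c
  at-++ (x ∷ X) E zero    e = e
  at-++ (x ∷ X) E (suc i) e = at-++ X E i e

  at-defined : ∀ (X : Word) i → i < length X → ∃[ c ] (at X i ≡ just c)
  at-defined (x ∷ X) zero    _       = x , refl
  at-defined (x ∷ X) (suc i) (s≤s l) = at-defined X i l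

  at-ξ^-stable : ∀ m n i {c} → at (ξ^ m [𝟘]) i ≡ just c → at (ξ^ (n + m) [𝟘]) i ≡ just c
  at-ξ^-stable m n i e with ξ^-prefix n m
  ... | E , eE rewrite eE = at-++ (ξ^ m [𝟘]) E i e

  u-at : ∀ M i → i < length (ξ^ M [𝟘]) → at (ξ^ M [𝟘]) i ≡ just (u i)
  u-at M i l with at-defined (ξ^ M [𝟘]) i l | at-defined (ξ^ (suc i) [𝟘]) i (≤-trans (n≤1+n _) (n<length-ξ^ (suc i)))
  ... | c , e | c′ , e′ rewrite e′ = trans e (cong just (just-injective c≡c′))
    where
    c≡c′ : just c ≡ just c′
    c≡c′ = trans (sym (at-ξ^-stable M (suc i) i e))
             (trans (cong (λ m → at (ξ^ m [𝟘]) i) (+-comm (suc i) M)) (at-ξ^-stable (suc i) M i e′))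

  occurs-if-at : ∀ (X : Word) o → (∀ i → i < length X → at X i ≡ just (u (o + i))) → OccursAt X o
  occurs-if-at []      o _ = tt
  occurs-if-at (x ∷ X) o h =
    just-injective (trans (cong (just ∘ u) (sym (+-identityʳ o))) (sym (h 0 (s≤s z≤n)))) ,
    occurs-if-at X (suc o) (λ i l → trans (h (suc i) (s≤s l)) (cong (just ∘ u) (+-suc o i)))

  ξ^-occurs : ∀ M → OccursAt (ξ^ M [𝟘]) 0
  ξ^-occurs M = occurs-if-at _ 0 (u-at M)

  occurs-++⁻ : ∀ (A B : Word) j → OccursAt (A ++ B) j → OccursAt A j × OccursAt B (j + length A)
  occurs-++⁻ []      B j oc       = tt , subst (OccursAt B) (sym (+-identityʳ j)) oc
  occurs-++⁻ (a ∷ A) B j (e , oc) with occurs-++⁻ A B (suc j) oc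
  ... | oA , oB = (e , oA) , subst (OccursAt B) (sym (+-suc j (length A))) oB

  occurs-++⁺ : ∀ (A B : Word) j → OccursAt A j → OccursAt B (j + length A) → OccursAt (A ++ B) j
  occurs-++⁺ []      B j _        oB = subst (OccursAt B) (+-identityʳ j) oB
  occurs-++⁺ (a ∷ A) B j (e , oA) oB = e , occurs-++⁺ A B (suc j) oA (subst (OccursAt B) (+-suc j (length A)) oB)

  slice-occurs : ∀ (W : Word) j → OccursAt W j → slice j (length W) ≡ W
  slice-occurs []      j _        = refl
  slice-occurs (c ∷ W) j (e , oc) = cong₂ _∷_ e (slice-occurs W (suc j) oc)

  slice-+ : ∀ j m n → slice j (m + n) ≡ slice j m ++ slice (j + m) n
  slice-+ j zero    n = cong (λ i → slice i n) (sym (+-identityʳ j))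
  slice-+ j (suc m) n = cong (u j ∷_) (trans (slice-+ (suc j) m n) (cong (λ i → slice (suc j) m ++ slice i n) (sym (+-suc j m))))

  length-slice : ∀ j n → length (slice j n) ≡ n
  length-slice j zero    = refl
  length-slice j (suc n) = cong suc (length-slice (suc j) n)

  InIterate : Word → Set
  InIterate W = ∃[ M ] ∃[ A ] ∃[ B ] (ξ^ M [𝟘] ≡ A ++ W ++ B)

  InIterate-occurs : ∀ M (A W B : Word) → ξ^ M [𝟘] ≡ A ++ W ++ B → OccursAt W (length A)
  InIterate-occurs M A W B e =
    proj₁ (occurs-++⁻ W B _ (proj₂ (occurs-++⁻ A (W ++ B) 0 (subst (λ X → OccursAt X 0) e (ξ^-occurs M)))))

  Factor⇒InIterate : ∀ {W} → Factor W → InIterate W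
  Factor⇒InIterate {W} (i , oc) = M , slice 0 i , slice (i + length W) r , chain
    where
    M r : ℕ
    M = i + length W
    r = length (ξ^ M [𝟘]) ∸ M
    chain : ξ^ M [𝟘] ≡ slice 0 i ++ W ++ slice (i + length W) r
    chain = begin
      ξ^ M [𝟘]                                          ≡⟨ sym (slice-occurs _ 0 (ξ^-occurs M)) ⟩
      slice 0 (length (ξ^ M [𝟘]))                        ≡⟨ cong (slice 0) (sym (m+[n∸m]≡n (<⇒≤ (n<length-ξ^ M)))) ⟩
      slice 0 (M + r)                                   ≡⟨ cong (slice 0) (+-assoc i (length W) r) ⟩
      slice 0 (i + (length W + r))                      ≡⟨ slice-+ 0 i _ ⟩
      slice 0 i ++ slice i (length W + r)               ≡⟨ cong (slice 0 i ++_) (slice-+ i (length W) r) ⟩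
      slice 0 i ++ slice i (length W) ++ slice M r      ≡⟨ cong (λ X → slice 0 i ++ X ++ slice M r) (slice-occurs W i oc) ⟩
      slice 0 i ++ W ++ slice M r                       ∎
      where open ≡-Reasoning

  InIterate-infix : ∀ (A W B : Word) → InIterate (A ++ W ++ B) → InIterate W
  InIterate-infix A W B (M , A′ , B′ , e) = M , A′ ++ A , B ++ B′ , trans e (reassoc A′)
    where
    reassoc : ∀ A′ → A′ ++ (A ++ W ++ B) ++ B′ ≡ (A′ ++ A) ++ W ++ B ++ B′
    reassoc A′ = begin
      A′ ++ (A ++ W ++ B) ++ B′   ≡⟨ cong (A′ ++_) (trans (++-assoc A (W ++ B) B′) (cong (A ++_) (++-assoc W B B′))) ⟩
      A′ ++ A ++ W ++ B ++ B′     ≡⟨ sym (++-assoc A′ A _) ⟩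
      (A′ ++ A) ++ W ++ B ++ B′   ∎
      where open ≡-Reasoning

  InIterate-ξ^ : ∀ n {W} → InIterate W → InIterate (ξ^ n W)
  InIterate-ξ^ n {W} (M , A , B , e) = n + M , ξ^ n A , ξ^ n B , chain
    where
    chain : ξ^ (n + M) [𝟘] ≡ ξ^ n A ++ ξ^ n W ++ ξ^ n B
    chain = begin
      ξ^ (n + M) [𝟘]                 ≡⟨ ξ^-+ n M [𝟘] ⟩
      ξ^ n (ξ^ M [𝟘])                ≡⟨ cong (ξ^ n) e ⟩
      ξ^ n (A ++ W ++ B)             ≡⟨ ξ^-++ n A (W ++ B) ⟩
      ξ^ n A ++ ξ^ n (W ++ B)        ≡⟨ cong (ξ^ n A ++_) (ξ^-++ n W B) ⟩
      ξ^ n A ++ ξ^ n W ++ ξ^ n B     ∎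
      where open ≡-Reasoning

  Run : Bool → ℕ → Word → Set
  Run b s []      = ⊤
  Run b s (c ∷ L) = primed c ≡ b × index c ≡ s × Run b (suc s) L

  Run-nonzero : ∀ b s (L : Word) → Run b (suc s) L → All (¬_ ∘ IsZero) L
  Run-nonzero b s []      _            = []
  Run-nonzero b s (c ∷ L) (_ , ic , r) = (λ z → 0≢1+n (trans (sym z) ic)) ∷ Run-nonzero b (suc s) L r

  Run-last : ∀ b s (L : Word) m → Run b s L → length L ≡ suc m →
    ∃[ L₀ ] ∃[ ℓ ] (L ≡ L₀ ++ ℓ ∷ [] × primed ℓ ≡ b × index ℓ ≡ s + m)
  Run-last b s (c ∷ [])     zero    (pc , ic , _) _ = [] , c , refl , pc , trans ic (sym (+-identityʳ s))
  Run-last b s (c ∷ c′ ∷ L) (suc m) (_ , _ , r)   l with Run-last b (suc s) (c′ ∷ L) m r (suc-injective l)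
  ... | L₀ , ℓ , e , pℓ , iℓ = c ∷ L₀ , ℓ , cong (c ∷_) e , pℓ , trans iℓ (sym (+-suc s m))

  ξ-inner-run : ∀ b s (L : Word) → Run b s L → ¬ s ≡ 0 → s + length L < k →
    Run b (suc s) (ξ L) × length (ξ L) ≡ length L
  ξ-inner-run b s []      _              _  _ = tt , refl
  ξ-inner-run b s (c ∷ L) (pc , ic , r) s≢0 lt with ξ-view c
  ... | zero-letter _ z _ _     = ⊥-elim (s≢0 (trans (sym ic) z))
  ... | top-letter _ t _ _ _    = ⊥-elim (<-irrefl (trans (cong suc (sym ic)) t) (≤-<-trans (m≤m+n (suc s) (length L)) lt′))
    where
    lt′ : suc s + length L < k
    lt′ = subst (_< k) (+-suc s (length L)) lt
  ... | inner-letter c′ _ (pc′ , ic′) e rewrite e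
      with ξ-inner-run b (suc s) L r (0≢1+n ∘ sym) (subst (_< k) (+-suc s (length L)) lt)
  ...   | r′ , l′ = (trans pc′ pc , trans ic′ (cong suc ic) , r′) , cong suc l′

  ξ^-zero-run : ∀ {a} → IsZero a → ∀ t → t < k → Run (primed a) 0 (ξ^ t (a ∷ [])) × length (ξ^ t (a ∷ [])) ≡ suc t
  ξ^-zero-run za zero    _  = (refl , za , tt) , refl
  ξ^-zero-run {a} za (suc t) lt with ξ^ t (a ∷ []) | ξ^-zero-run {a} za t (<-trans (n<1+n t) lt)
  ... | c ∷ L | (pc , ic , r) , l with ξ-view c
  ...   | inner-letter _ ¬z _ _  = ⊥-elim (¬z ic)
  ...   | top-letter _ top _ _ _ = ⊥-elim (zero≢top {c} ic top)
  ...   | zero-letter o _ (po , io) e rewrite e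
        with ξ-inner-run (primed a) 1 L r (0≢1+n ∘ sym) (subst (λ m → suc m < k) (sym (suc-injective l)) lt)
  ...     | r′ , l′ = (pc , ic , trans po pc , trans io (cong suc ic) , r′) , cong (suc ∘ suc) (trans l′ (suc-injective l))

  ξ^-inner : ∀ {a} → ¬ IsZero a → ∀ t → index a + t < k →
    ∃[ c ] (ξ^ t (a ∷ []) ≡ c ∷ [] × primed c ≡ primed a × index c ≡ index a + t)
  ξ^-inner {a} ¬za zero    _  = a , refl , refl , sym (+-identityʳ _)
  ξ^-inner {a} ¬za (suc t) lt with ξ^-inner {a} ¬za t (≤-<-trans (+-monoʳ-≤ (index a) (n≤1+n t)) lt)
  ... | c , e , pc , ic rewrite e with ξ-view c
  ...   | zero-letter _ z _ _  = ⊥-elim (¬za (m+n≡0⇒m≡0 (index a) (trans (sym ic) z)))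
  ...   | top-letter _ top _ _ _ = ⊥-elim (<-irrefl (trans (+-suc (index a) t) (trans (cong suc (sym ic)) top)) lt)
  ...   | inner-letter c′ _ (pc′ , ic′) e′ =
          c′ , trans (++-identityʳ _) e′ , trans pc′ pc , trans ic′ (trans (cong suc ic) (sym (+-suc (index a) t)))

  K : ℕ
  K = k ∸ 1

  suc-K : suc K ≡ k
  suc-K = trans (+-comm 1 K) (m∸n+n≡m (≤-trans (s≤s z≤n) hk))

  K<k : K < k
  K<k = subst (K <_) suc-K ≤-refl

  ρ : Letter → Word
  ρ a = ξ^ K (a ∷ [])

  ρ-zero : ∀ {a} → IsZero a → Run (primed a) 0 (ρ a) × length (ρ a) ≡ k
  ρ-zero {a} za = let run , l = ξ^-zero-run {a} za K K<k in run , trans l suc-K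

  index≤K : ∀ a → index a ≤ K
  index≤K a = ≤-pred (subst (suc (index a) ≤_) (sym suc-K) (index<k a))

  -- a ↦ a+1 ↦ ⋯ ↦ k-1 ↦ 0̄ ↦ 0̄1̄ ↦ ⋯ ↦ 0̄1̄⋯(a-1)̄, where ̄ swaps primes; K = (a-1) + 1 + (K-a).
  ρ-nonzero : ∀ {a i} → index a ≡ suc i → Run (not (primed a)) 0 (ρ a) × length (ρ a) ≡ suc i
  ρ-nonzero {a} {i} ia
    with ξ^-inner {a} (suc-index⇒¬IsZero {a} ia) (K ∸ index a) (subst (_< k) (sym (m+[n∸m]≡n (index≤K a))) K<k)
  ... | c , ec , pc , ic with ξ-view c
  ...   | zero-letter _ z _ _          = ⊥-elim (suc-index⇒¬IsZero {a} ia (m+n≡0⇒m≡0 (index a) (trans (sym ic) z)))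
  ...   | inner-letter c′ _ (_ , ic′) _ =
          ⊥-elim (<-irrefl (trans ic′ (trans (cong suc (trans ic (m+[n∸m]≡n (index≤K a)))) suc-K)) (index<k c′))
  ...   | top-letter z _ iz pz e with ξ^-zero-run {z} iz i (<-trans (n<1+n i) (subst (_< k) ia (index<k a)))
  ...     | r , l = subst (λ p → Run p 0 (ρ a)) (trans pz (cong not pc)) (subst (Run (primed z) 0) (sym ρa≡) r) ,
                    trans (cong length ρa≡) l
    where
    K≡ : i + suc (K ∸ index a) ≡ K
    K≡ = trans (+-suc i _) (trans (cong (_+ (K ∸ index a)) (sym ia)) (m+[n∸m]≡n (index≤K a)))
    ρa≡ : ρ a ≡ ξ^ i (z ∷ [])
    ρa≡ = begin
      ξ^ K (a ∷ [])                                ≡⟨ cong (λ m → ξ^ m (a ∷ [])) (sym K≡) ⟩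
      ξ^ (i + suc (K ∸ index a)) (a ∷ [])          ≡⟨ ξ^-+ i (suc (K ∸ index a)) (a ∷ []) ⟩
      ξ^ i (ξ (ξ^ (K ∸ index a) (a ∷ [])))         ≡⟨ cong (ξ^ i ∘ ξ) ec ⟩
      ξ^ i (ξ-letter c ++ [])                      ≡⟨ cong (λ w → ξ^ i (w ++ [])) e ⟩
      ξ^ i (z ∷ [])                                ∎
      where open ≡-Reasoning

  index-cases : ∀ a → IsZero a ⊎ ∃[ i ] (index a ≡ suc i)
  index-cases a with index a
  ... | zero  = inj₁ refl
  ... | suc i = inj₂ (i , refl)

  Run-from-zero : ∀ b (L : Word) n → Run b 0 L → length L ≡ suc n →
    ∃[ T ] (L ≡ (b , fzero) ∷ T × All (¬_ ∘ IsZero) T)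
  Run-from-zero b (c ∷ T) n (pc , ic , r) _ =
    T , cong (_∷ T) (Letter-≡ pc (trans ic (sym index-fzero))) , Run-nonzero b 0 T r

  ρ-zero-head : ∀ {a} → IsZero a → ∃[ T ] (ρ a ≡ (primed a , fzero) ∷ T × All (¬_ ∘ IsZero) T)
  ρ-zero-head {a} za with ρ-zero {a} za
  ... | r , l = Run-from-zero _ (ρ a) K r (trans l (sym suc-K))

  ρ-nonzero-head : ∀ {a i} → index a ≡ suc i → ∃[ T ] (ρ a ≡ (not (primed a) , fzero) ∷ T × All (¬_ ∘ IsZero) T)
  ρ-nonzero-head {a} ia with ρ-nonzero {a} ia
  ... | r , l = Run-from-zero _ (ρ a) _ r l

  ρ-shape : ∀ a → ∃[ c ] ∃[ T ] (ρ a ≡ c ∷ T × IsZero c × All (¬_ ∘ IsZero) T)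
  ρ-shape a with index-cases a
  ... | inj₁ za       = let T , e , u = ρ-zero-head {a} za in _ , T , e , index-fzero , u
  ... | inj₂ (i , ia) = let T , e , u = ρ-nonzero-head {a} ia in _ , T , e , index-fzero , u

  ρ-zero≢ρ-nonzero : ∀ {a a′ i} → IsZero a → index a′ ≡ suc i → ρ a ≢ ρ a′
  ρ-zero≢ρ-nonzero {a} {a′} za ia′ e =
    <-irrefl (trans (sym (proj₂ (ρ-nonzero {a′} ia′))) (trans (cong length (sym e)) (proj₂ (ρ-zero {a} za))))
             (subst (_< k) ia′ (index<k a′))

  ρ-heads-≡ : ∀ {a a′ c c′ T T′} → ρ a ≡ c ∷ T → ρ a′ ≡ c′ ∷ T′ → ρ a ≡ ρ a′ → c ≡ c′
  ρ-heads-≡ ea ea′ e = ∷-injectiveˡ (trans (sym ea) (trans e ea′))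

  length-ρ-nonzero : ∀ {a i} → index a ≡ suc i → length (ρ a) ≡ index a
  length-ρ-nonzero {a} ia = trans (proj₂ (ρ-nonzero {a} ia)) (sym ia)

  ρ-injective : ∀ {a a′} → ρ a ≡ ρ a′ → a ≡ a′
  ρ-injective {a} {a′} e with index-cases a | index-cases a′
  ... | inj₁ za       | inj₁ za′       =
        let _ , ea , _ = ρ-zero-head {a} za ; _ , ea′ , _ = ρ-zero-head {a′} za′
        in Letter-≡ (cong proj₁ (ρ-heads-≡ ea ea′ e)) (trans za (sym za′))
  ... | inj₁ za       | inj₂ (_ , ia′) = ⊥-elim (ρ-zero≢ρ-nonzero {a} {a′} za ia′ e)
  ... | inj₂ (_ , ia) | inj₁ za′       = ⊥-elim (ρ-zero≢ρ-nonzero {a′} {a} za′ ia (sym e))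
  ... | inj₂ (_ , ia) | inj₂ (_ , ia′) =
        let _ , ea , _ = ρ-nonzero-head {a} ia ; _ , ea′ , _ = ρ-nonzero-head {a′} ia′
        in Letter-≡ (not-injective (cong proj₁ (ρ-heads-≡ ea ea′ e)))
                    (trans (sym (length-ρ-nonzero {a} ia)) (trans (cong length e) (length-ρ-nonzero {a′} ia′)))

  ρ* : Word → Word
  ρ* = concatMap ρ

  ξ^K≡ρ* : ∀ (Y : Word) → ξ^ K Y ≡ ρ* Y
  ξ^K≡ρ* = ξ^-concatMap K

  open MarkedCode IsZero ρ ρ-shape ρ-injective

  -- Local rules, on windows of length ≤ 4, obeyed by every factor of u; 0 and 1 stand for either prime.
  StepHead : Word → Set
  StepHead (a ∷ c ∷ _) = IsZero c ⊎ Succ a c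
  StepHead _           = ⊤

  No100Head : Word → Set
  No100Head (a ∷ b ∷ c ∷ _) = IsOne a → IsZero b → IsZero c → ⊥
  No100Head _               = ⊤

  No1010Head : Word → Set
  No1010Head (a ∷ b ∷ c ∷ d ∷ _) = IsOne a → IsZero b → IsOne c → IsZero d → ⊥
  No1010Head _                   = ⊤

  No000Head : Word → Set
  No000Head (a ∷ b ∷ c ∷ _) = IsZero a → IsZero b → IsZero c → ⊥
  No000Head _               = ⊤

  Window : Word → Set
  Window X = StepHead X × No100Head X × No1010Head X × No000Head X

  Good : Word → Set
  Good []      = ⊤
  Good (a ∷ X) = Window (a ∷ X) × Good X

  Good-++⁻ʳ : ∀ (A B : Word) → Good (A ++ B) → Good B
  Good-++⁻ʳ []      B g       = g
  Good-++⁻ʳ (a ∷ A) B (_ , g) = Good-++⁻ʳ A B g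

  ¬IsOne⇒No100-No1010 : ∀ {a} X → ¬ IsOne a → No100Head (a ∷ X) × No1010Head (a ∷ X)
  ¬IsOne⇒No100-No1010 []              _  = tt , tt
  ¬IsOne⇒No100-No1010 (_ ∷ [])        _  = tt , tt
  ¬IsOne⇒No100-No1010 (_ ∷ _ ∷ [])    ¬o = (λ o _ _ → ¬o o) , tt
  ¬IsOne⇒No100-No1010 (_ ∷ _ ∷ _ ∷ _) ¬o = (λ o _ _ → ¬o o) , (λ o _ _ _ → ¬o o)

  ¬IsZero⇒No000 : ∀ {a} X → ¬ IsZero a → No000Head (a ∷ X)
  ¬IsZero⇒No000 []           _  = tt
  ¬IsZero⇒No000 (_ ∷ [])     _  = tt
  ¬IsZero⇒No000 (_ ∷ _ ∷ _)  ¬z = λ z _ _ → ¬z z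

  ¬IsZero₂⇒Window : ∀ {a b} X → StepHead (a ∷ b ∷ X) → ¬ IsZero b → Window (a ∷ b ∷ X)
  ¬IsZero₂⇒Window []          s _  = s , tt , tt , tt
  ¬IsZero₂⇒Window (_ ∷ [])    s ¬z = s , (λ _ z _ → ¬z z) , tt , (λ _ z _ → ¬z z)
  ¬IsZero₂⇒Window (_ ∷ _ ∷ _) s ¬z = s , (λ _ z _ → ¬z z) , (λ _ z _ _ → ¬z z) , (λ _ z _ → ¬z z)

  Window-ξ-zero : ∀ {a o} X → IsZero a → Succ a o → Good (a ∷ X) → Window (o ∷ ξ X)
  Window-ξ-zero [] _ _ _ = tt , tt , tt , tt
  Window-ξ-zero {a} {o} (b ∷ X) za so ((step , _ , _ , no000) , gbX) with ξ-view b
  ... | zero-letter ob zb sob eb rewrite eb =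
        inj₁ zb , (λ _ _ z → Succ⇒¬IsZero sob z) , no1010 X no000 gbX , ¬IsZero⇒No000 {o} (b ∷ ob ∷ ξ X) (IsOne⇒¬IsZero {o} oo)
    where
    oo : IsOne o
    oo = Succ-IsZero⇒IsOne so za
    no1010 : ∀ X → No000Head (a ∷ b ∷ X) → Good (b ∷ X) → No1010Head (o ∷ b ∷ ob ∷ ξ X)
    no1010 []      _     _                 = tt
    no1010 (d ∷ X) no000 ((stepb , _) , _) with ξ-view d
    ... | zero-letter _ zd _ ed rewrite ed = λ _ _ _ _ → no000 za zb zd
    ... | inner-letter _ _ sd ed rewrite ed = λ _ _ _ z → Succ⇒¬IsZero sd z
    ... | top-letter _ td _ _ ed with stepb
    ...   | inj₁ zd = ⊥-elim (zero≢top {d} zd td)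
    ...   | inj₂ sbd = ⊥-elim (one≢top {d} (Succ-IsZero⇒IsOne sbd zb) td)
  ... | inner-letter c′ ¬zb (pc′ , ic′) eb rewrite eb with step
  ...   | inj₁ zb = ⊥-elim (¬zb zb)
  ...   | inj₂ (pb , ib) =
          ¬IsZero₂⇒Window (ξ X) (inj₂ (trans pc′ (trans pb (sym (proj₁ so))) , trans ic′ (cong suc (trans ib (sym (proj₂ so))))))
                          (suc-index⇒¬IsZero {c′} ic′)
  Window-ξ-zero {a} {o} (b ∷ X) za so ((step , _) , _) | top-letter _ tb _ _ _ with step
  ...   | inj₁ zb  = ⊥-elim (zero≢top {b} zb tb)
  ...   | inj₂ sab = ⊥-elim (one≢top {b} (Succ-IsZero⇒IsOne sab za) tb)

  Window-ξ-inner : ∀ {a c} X → ¬ IsZero a → Succ a c → Good (a ∷ X) → Window (c ∷ ξ X)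
  Window-ξ-inner {a} {c} X ¬za (pc , ic) ((step , _) , _) =
    step-ξ X step , ¬IsOne⇒No100-No1010 {c} (ξ X) ¬oc .proj₁ , ¬IsOne⇒No100-No1010 {c} (ξ X) ¬oc .proj₂ ,
    ¬IsZero⇒No000 {c} (ξ X) (suc-index⇒¬IsZero {c} ic)
    where
    ¬oc : ¬ IsOne c
    ¬oc oc = ¬za (suc-injective (trans (sym ic) oc))
    step-ξ : ∀ X → StepHead (a ∷ X) → StepHead (c ∷ ξ X)
    step-ξ []      _    = tt
    step-ξ (b ∷ X) step with ξ-view b
    ... | zero-letter _ zb _ eb  rewrite eb = inj₁ zb
    ... | top-letter _ _ zb′ _ eb rewrite eb = inj₁ zb′
    ... | inner-letter _ ¬zb (pb′ , ib′) eb rewrite eb with step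
    ...   | inj₁ zb        = ⊥-elim (¬zb zb)
    ...   | inj₂ (pb , ib) = inj₂ (trans pb′ (trans pb (sym pc)) , trans ib′ (cong suc (trans ib (sym ic))))

  Window-ξ-top : ∀ {a c} X → suc (index a) ≡ k → IsZero c → Good (a ∷ X) → Window (c ∷ ξ X)
  Window-ξ-top {a} {c} []      _  _  _ = tt , tt , tt , tt
  Window-ξ-top {a} {c} (b ∷ X) ta zc ((step , _) , _) with step
  ... | inj₂ (_ , ib) = ⊥-elim (<-irrefl (trans ib ta) (index<k b))
  ... | inj₁ zb with ξ-view b
  ...   | inner-letter _ ¬zb _ _ = ⊥-elim (¬zb zb)
  ...   | top-letter _ tb _ _ _  = ⊥-elim (zero≢top {b} zb tb)
  ...   | zero-letter ob _ sob eb rewrite eb =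
          inj₁ zb , ¬IsOne⇒No100-No1010 {c} (b ∷ ob ∷ ξ X) ¬oc .proj₁ , ¬IsOne⇒No100-No1010 {c} (b ∷ ob ∷ ξ X) ¬oc .proj₂ ,
          (λ _ _ z → Succ⇒¬IsZero sob z)
    where
    ¬oc : ¬ IsOne c
    ¬oc oc = 0≢1+n (trans (sym zc) oc)

  Good-ξ : ∀ X → Good X → Good (ξ X)
  Good-ξ []      _         = tt
  Good-ξ (a ∷ X) (wa , gX) with ξ-view a
  ... | zero-letter o za so e rewrite e =
        ¬IsZero₂⇒Window (ξ X) (inj₂ so) (Succ⇒¬IsZero so) , Window-ξ-zero X za so (wa , gX) , Good-ξ X gX
  ... | inner-letter c ¬za sc e rewrite e = Window-ξ-inner X ¬za sc (wa , gX) , Good-ξ X gX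
  ... | top-letter c ta zc _ e rewrite e  = Window-ξ-top X ta zc (wa , gX) , Good-ξ X gX

  Good-ξ^ : ∀ n → Good (ξ^ n [𝟘])
  Good-ξ^ zero    = (tt , tt , tt , tt) , tt
  Good-ξ^ (suc n) = Good-ξ _ (Good-ξ^ n)

  -- ξᴹ(0) is a prefix of ξ^(K+M)(0) = ρ*(ξᴹ(0)), and ρ* is a marked code.
  recognise : ∀ (P : Word) c (R : Word) → InIterate (ρ* P ++ c ∷ R) → IsZero c →
    ∃[ Y ] ∃[ S ] (Good (P ++ Y) × ρ* Y ≡ c ∷ R ++ S)
  recognise P c R (M , A , B , e) zc with concatMap-split-at-mark X A C ρ*X≡ (MarkedHead-++ (ρ* P) _ (MarkedHead-concatMap P) zc)
    where
    X E C : Word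
    X = ξ^ M [𝟘]
    E = proj₁ (ξ^-prefix K M)
    C = ρ* P ++ c ∷ R ++ B ++ E
    ρ*X≡ : ρ* X ≡ A ++ C
    ρ*X≡ = begin
      ρ* X                                  ≡⟨ sym (ξ^K≡ρ* X) ⟩
      ξ^ K X                                ≡⟨ sym (ξ^-+ K M [𝟘]) ⟩
      ξ^ (K + M) [𝟘]                        ≡⟨ proj₂ (ξ^-prefix K M) ⟩
      X ++ E                                ≡⟨ cong (_++ E) e ⟩
      (A ++ (ρ* P ++ c ∷ R) ++ B) ++ E      ≡⟨ ++-assoc A _ E ⟩
      A ++ ((ρ* P ++ c ∷ R) ++ B) ++ E      ≡⟨ cong (A ++_) (++-assoc (ρ* P ++ c ∷ R) B E) ⟩
      A ++ (ρ* P ++ c ∷ R) ++ B ++ E        ≡⟨ cong (A ++_) (++-assoc (ρ* P) (c ∷ R) (B ++ E)) ⟩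
      A ++ C                                ∎
      where open ≡-Reasoning
  ... | X₁ , X₂ , eX , _ , eX₂ with concatMap-cancel-prefix P X₂ (c ∷ R ++ _) eX₂ zc
  ...   | Y , refl , eY = Y , _ , Good-++⁻ʳ X₁ (P ++ Y) (subst Good eX (Good-ξ^ M)) , eY

  Run-singleton : ∀ b (L : Word) → Run b 0 L → length L ≡ 1 → L ≡ (b , fzero) ∷ []
  Run-singleton b (c ∷ []) (pc , ic , _) _ = cong (_∷ []) (Letter-≡ pc (trans ic (sym index-fzero)))

  ρ-one : ∀ {o} → IsOne o → ρ o ≡ (not (primed o) , fzero) ∷ []
  ρ-one {o} oo = let run , l = ρ-nonzero {o} oo in Run-singleton _ (ρ o) run l

  ξ^k-zero : ∀ {z} → IsZero z → ∃[ o ] (Succ z o × ξ^ k (z ∷ []) ≡ ρ z ++ ρ o)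
  ξ^k-zero {z} iz with ξ-letter-zero {z} iz
  ... | o , so , e = o , so , chain
    where
    chain : ξ^ k (z ∷ []) ≡ ρ z ++ ρ o
    chain = begin
      ξ^ k (z ∷ [])              ≡⟨ cong (λ m → ξ^ m (z ∷ [])) (sym suc-K) ⟩
      ξ^ (suc K) (z ∷ [])        ≡⟨ ξ^-suc K (z ∷ []) ⟩
      ξ^ K (ξ-letter z ++ [])    ≡⟨ cong (λ w → ξ^ K (w ++ [])) e ⟩
      ξ^ K (z ∷ o ∷ [])          ≡⟨ ξ^-++ K (z ∷ []) (o ∷ []) ⟩
      ρ z ++ ρ o                 ∎
      where open ≡-Reasoning

  ξ^-zero-end : ∀ W {z} → IsZero z → ∀ t → t < k → ∃[ L ] ∃[ ℓ ] (ξ^ t (W ++ z ∷ []) ≡ L ++ ℓ ∷ [] × index ℓ ≡ t)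
  ξ^-zero-end W {z} iz t t<k =
    let run , l = ξ^-zero-run {z} iz t t<k
        L₀ , ℓ , eL , _ , iℓ = Run-last (primed z) 0 _ t run l
    in ξ^ t W ++ L₀ , ℓ , trans (ξ^-++ t W (z ∷ [])) (trans (cong (ξ^ t W ++_) eL) (sym (++-assoc (ξ^ t W) L₀ _))) , iℓ

  ξ^k-zero-end : ∀ W {z} → IsZero z → ∃[ V ] ∃[ t ] ∃[ z′ ]
    (ξ^ k (W ++ z ∷ []) ≡ V ++ t ∷ z′ ∷ [] × suc (index t) ≡ k × IsZero z′ × primed z′ ≡ not (primed t))
  ξ^k-zero-end W {z} iz =
    let o , so , e = ξ^k-zero {z} iz
        run , l = ρ-zero {z} iz
        L₀ , t , et , pt , it = Run-last (primed z) 0 (ρ z) K run (trans l (sym suc-K))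
    in ξ^ k W ++ L₀ , t , _ , chain e et (ρ-one {o} (Succ-IsZero⇒IsOne so iz)) , trans (cong suc it) suc-K , index-fzero ,
       cong not (trans (proj₁ so) (sym pt))
    where
    chain : ∀ {o L₀ t} → ξ^ k (z ∷ []) ≡ ρ z ++ ρ o → ρ z ≡ L₀ ++ t ∷ [] → ρ o ≡ (not (primed o) , fzero) ∷ [] →
      ξ^ k (W ++ z ∷ []) ≡ (ξ^ k W ++ L₀) ++ t ∷ (not (primed o) , fzero) ∷ []
    chain {o} {L₀} {t} e et eo = begin
      ξ^ k (W ++ z ∷ [])                                  ≡⟨ ξ^-++ k W (z ∷ []) ⟩
      ξ^ k W ++ ξ^ k (z ∷ [])                             ≡⟨ cong (ξ^ k W ++_) (trans e (cong₂ _++_ et eo)) ⟩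
      ξ^ k W ++ (L₀ ++ t ∷ []) ++ (not (primed o) , fzero) ∷ []  ≡⟨ cong (ξ^ k W ++_) (++-assoc L₀ (t ∷ []) _) ⟩
      ξ^ k W ++ L₀ ++ t ∷ (not (primed o) , fzero) ∷ []   ≡⟨ sym (++-assoc (ξ^ k W) L₀ _) ⟩
      (ξ^ k W ++ L₀) ++ t ∷ (not (primed o) , fzero) ∷ [] ∎
      where open ≡-Reasoning

  ξ^k-top-zero-end : ∀ V {t z} → suc (index t) ≡ k → IsZero z → primed z ≡ not (primed t) →
    ∃[ c ] (ξ^ k (V ++ t ∷ z ∷ []) ≡ ρ* (ξ V ++ z ∷ z ∷ []) ++ c ∷ [] × IsZero c)
  ξ^k-top-zero-end V {t} {z} tt′ iz pz with ξ-view t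
  ... | zero-letter _ zt _ _        = ⊥-elim (zero≢top {t} zt tt′)
  ... | inner-letter c _ (_ , ic) _ = ⊥-elim (<-irrefl (trans ic tt′) (index<k c))
  ... | top-letter c _ zc pc et with ξ-letter-zero {z} iz
  ...   | o , so , ez = _ , chain , index-fzero
    where
    c≡z : c ≡ z
    c≡z = Letter-≡ (trans pc (sym pz)) (trans zc (sym iz))
    ξ-end : ξ (V ++ t ∷ z ∷ []) ≡ (ξ V ++ z ∷ z ∷ []) ++ o ∷ []
    ξ-end = begin
      ξ (V ++ t ∷ z ∷ [])                     ≡⟨ ξ-++ V (t ∷ z ∷ []) ⟩
      ξ V ++ ξ-letter t ++ ξ-letter z ++ []   ≡⟨ cong₂ (λ a b → ξ V ++ a ++ b ++ []) et ez ⟩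
      ξ V ++ c ∷ z ∷ o ∷ []                   ≡⟨ cong (λ a → ξ V ++ a ∷ z ∷ o ∷ []) c≡z ⟩
      ξ V ++ z ∷ z ∷ o ∷ []                   ≡⟨ sym (++-assoc (ξ V) (z ∷ z ∷ []) (o ∷ [])) ⟩
      (ξ V ++ z ∷ z ∷ []) ++ o ∷ []           ∎
      where open ≡-Reasoning
    chain : ξ^ k (V ++ t ∷ z ∷ []) ≡ ρ* (ξ V ++ z ∷ z ∷ []) ++ (not (primed o) , fzero) ∷ []
    chain = begin
      ξ^ k (V ++ t ∷ z ∷ [])                      ≡⟨ cong (λ m → ξ^ m (V ++ t ∷ z ∷ [])) (sym suc-K) ⟩
      ξ^ (suc K) (V ++ t ∷ z ∷ [])                ≡⟨ ξ^-suc K _ ⟩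
      ξ^ K (ξ (V ++ t ∷ z ∷ []))                  ≡⟨ cong (ξ^ K) ξ-end ⟩
      ξ^ K ((ξ V ++ z ∷ z ∷ []) ++ o ∷ [])        ≡⟨ ξ^-++ K (ξ V ++ z ∷ z ∷ []) (o ∷ []) ⟩
      ξ^ K (ξ V ++ z ∷ z ∷ []) ++ ρ o             ≡⟨ cong₂ _++_ (ξ^K≡ρ* _) (ρ-one {o} (Succ-IsZero⇒IsOne so iz)) ⟩
      ρ* (ξ V ++ z ∷ z ∷ []) ++ (not (primed o) , fzero) ∷ [] ∎
      where open ≡-Reasoning

  ξ^-+-[𝟘] : ∀ m n {X} → ξ^ n [𝟘] ≡ X → ξ^ (m + n) [𝟘] ≡ ξ^ m X
  ξ^-+-[𝟘] m n e = trans (ξ^-+ m n [𝟘]) (cong (ξ^ m) e)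

  ξ^qk-zero-end : ∀ q → ∃[ W ] ∃[ z ] (ξ^ (q * k) [𝟘] ≡ W ++ z ∷ [] × IsZero z)
  ξ^qk-zero-end zero    = [] , 𝟘 , refl , IsZero-𝟘
  ξ^qk-zero-end (suc q) =
    let W , z , e , iz = ξ^qk-zero-end q
        V , t , z′ , e′ , _ , iz′ , _ = ξ^k-zero-end W {z} iz
    in V ++ t ∷ [] , z′ , trans (ξ^-+-[𝟘] k (q * k) e) (trans e′ (sym (++-assoc V (t ∷ []) (z′ ∷ [])))) , iz′

  -- The two ways ξⁿ(0) ends when 1 ≤ n ≢ k; in neither case can it be followed by 1 or 1′ in u.
  data Ending (w : Word) : Set where
    nonzero-last : ∀ W ℓ → w ≡ W ++ ℓ ∷ [] → ¬ IsZero ℓ → Ending w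
    zero-zero    : ∀ W z c → w ≡ ρ* (W ++ z ∷ z ∷ []) ++ c ∷ [] → IsZero z → IsZero c → Ending w

  instance
    k-nonZero : NonZero k
    k-nonZero = >-nonZero (≤-trans (s≤s z≤n) hk)

  ξ^-ending : ∀ n → 1 ≤ n → n ≢ k → Ending (ξ^ n [𝟘])
  ξ^-ending n 1≤n n≢k = by-division (n % k) (n / k) (m%n<n n k) (m≡m%n+[m/n]*n n k)
    where
    by-division : ∀ r q → r < k → n ≡ r + q * k → Ending (ξ^ n [𝟘])
    by-division zero    zero           _  refl = ⊥-elim (<-irrefl refl 1≤n)
    by-division zero    (suc zero)     _  refl = ⊥-elim (n≢k (+-identityʳ k))
    by-division (suc r) q              lt refl =
      let W , z , e , iz = ξ^qk-zero-end q
          L , ℓ , eL , iℓ = ξ^-zero-end W {z} iz (suc r) lt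
      in nonzero-last L ℓ (trans (ξ^-+-[𝟘] (suc r) (q * k) e) eL) (suc-index⇒¬IsZero {ℓ} iℓ)
    by-division zero    (suc (suc q))  _  refl =
      let W , z , e , iz = ξ^qk-zero-end q
          V , t , z′ , e′ , tt′ , iz′ , pz′ = ξ^k-zero-end W {z} iz
          c , e″ , ic = ξ^k-top-zero-end V {t} {z′} tt′ iz′ pz′
      in zero-zero (ξ V) z′ c (trans (ξ^-+-[𝟘] k (suc q * k) (trans (ξ^-+-[𝟘] k (q * k) e) e′)) e″) iz′ ic

  ξ-cut : ∀ (v P S : Word) → ξ v ≡ P ++ S →
    (∃[ v₁ ] ∃[ v₂ ] (v ≡ v₁ ++ v₂ × ξ v₁ ≡ P × ξ v₂ ≡ S))
    ⊎ (∃[ P′ ] ∃[ z ] ∃[ o ] ∃[ S′ ] (P ≡ P′ ++ z ∷ [] × IsZero z × S ≡ o ∷ S′ × IsOne o))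
  ξ-cut v P S e with concatMap-cut ξ-letter v P S e
  ... | inj₁ cut = inj₁ cut
  ... | inj₂ (a , v₁ , v₂ , p , P′ , s , S′ , ea , refl , refl) with ξ-view a
  ...   | inner-letter c _ _ e′ with () ← proj₁ (singleton-≡-++-∷ c (p ∷ P′) S′ (trans (sym e′) ea))
  ...   | top-letter c _ _ _ e′ with () ← proj₁ (singleton-≡-++-∷ c (p ∷ P′) S′ (trans (sym e′) ea))
  ...   | zero-letter o za so e′ with ∷-injective (trans (sym e′) ea)
  ...     | refl , e″ with singleton-≡-++-∷ o P′ S′ e″
  ...       | refl , refl , refl = inj₂ (ξ v₁ , a , o , ξ v₂ , refl , za , refl , Succ-IsZero⇒IsOne so za)

  Succ-unless-zero : ∀ {a c} → IsZero c ⊎ Succ a c → ¬ IsZero c → Succ a c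
  Succ-unless-zero (inj₁ zc) ¬zc = ⊥-elim (¬zc zc)
  Succ-unless-zero (inj₂ sc) _   = sc

  zero-zero-not-followed-by-one : ∀ W {z c o} → IsZero z → IsZero c → IsOne o →
    ¬ InIterate (ρ* (W ++ z ∷ z ∷ []) ++ c ∷ o ∷ [])
  zero-zero-not-followed-by-one W {z} {c} {o} iz ic oo fac =
    let Y , S , g , eY = recognise (W ++ z ∷ z ∷ []) c (o ∷ []) fac ic
    in after-zz Y (Good-++⁻ʳ W (z ∷ z ∷ Y) (subst Good (++-assoc W (z ∷ z ∷ []) Y) g)) eY
    where
    after-zz : ∀ Y {S} → Good (z ∷ z ∷ Y) → ρ* Y ≢ c ∷ o ∷ S
    after-zz (y ∷ Y) {S} ((_ , _ , _ , no000) , (step , _) , _) e =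
      IsOne⇒¬IsZero {o} oo (subst MarkedHead ρ*Y≡ (MarkedHead-concatMap Y))
      where
      ρy≡ : ρ y ≡ (not (primed y) , fzero) ∷ []
      ρy≡ = ρ-one {y} (Succ-IsZero⇒IsOne (Succ-unless-zero step (no000 iz iz)) iz)
      ρ*Y≡ : ρ* Y ≡ o ∷ S
      ρ*Y≡ = ∷-injectiveʳ (trans (cong (_++ ρ* Y) (sym ρy≡)) e)

  sync-start : ∀ n → SyncPoint [] (ξ^ n [𝟘])
  sync-start n p s v _ _ _ e with ξ-cut v p (ξ^ n [𝟘] ++ s) e
  ... | inj₁ (v₁ , v₂ , ev , e₁ , e₂) = v₁ , v₂ , ev , trans e₁ (sym (++-identityʳ p)) , e₂
  ... | inj₂ (_ , _ , o , _ , _ , _ , eS , oo) with ξ^-𝟘-head n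
  ...   | T , eT = ⊥-elim (IsOne⇒¬IsZero {o} oo (subst IsZero (∷-injectiveˡ (trans (cong (_++ s) (sym eT)) eS)) IsZero-𝟘))

  sync-end : ∀ n → 1 ≤ n → n ≢ k → SyncPoint (ξ^ n [𝟘]) []
  sync-end n 1≤n n≢k p s v _ _ fv e with ξ-cut v (p ++ w) s ξv≡
    where
    w : Word
    w = ξ^ n [𝟘]
    ξv≡ : ξ v ≡ (p ++ w) ++ s
    ξv≡ = trans e (trans (cong (λ x → p ++ x ++ s) (++-identityʳ w)) (sym (++-assoc p w s)))
  ... | inj₁ cut = cut
  ... | inj₂ (P′ , z , o , S′ , eP , iz , refl , oo) with ξ^-ending n 1≤n n≢k
  ...   | nonzero-last W ℓ ew ¬zℓ = ⊥-elim (¬zℓ (subst IsZero (sym ℓ≡z) iz))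
    where
    ℓ≡z : ℓ ≡ z
    ℓ≡z = ∷ʳ-injectiveʳ (p ++ W) P′ (trans (++-assoc p W (ℓ ∷ [])) (trans (cong (p ++_) (sym ew)) eP))
  ...   | zero-zero W z′ c ew iz′ ic =
          ⊥-elim (zero-zero-not-followed-by-one W iz′ ic oo
                   (InIterate-infix p _ S′ (subst InIterate ξv≡′ (InIterate-ξ^ 1 (Factor⇒InIterate fv)))))
    where
    R : Word
    R = ρ* (W ++ z′ ∷ z′ ∷ [])
    ξv≡′ : ξ v ≡ p ++ (R ++ c ∷ o ∷ []) ++ S′
    ξv≡′ = begin
      ξ v                                   ≡⟨ e ⟩
      p ++ (ξ^ n [𝟘] ++ []) ++ o ∷ S′       ≡⟨ cong (λ x → p ++ x ++ o ∷ S′) (trans (++-identityʳ _) ew) ⟩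
      p ++ (R ++ c ∷ []) ++ o ∷ S′          ≡⟨ cong (p ++_) (++-assoc R (c ∷ []) (o ∷ S′)) ⟩
      p ++ R ++ c ∷ o ∷ S′                  ≡⟨ cong (p ++_) (sym (++-assoc R (c ∷ o ∷ []) S′)) ⟩
      p ++ (R ++ c ∷ o ∷ []) ++ S′          ∎
      where open ≡-Reasoning

  ξ^k-𝟘 : ξ^ k [𝟘] ≡ ρ 𝟘 ++ 𝟘′ ∷ []
  ξ^k-𝟘 = begin
    ξ^ k [𝟘]                ≡⟨ cong (λ m → ξ^ m [𝟘]) (sym suc-K) ⟩
    ξ^ (suc K) [𝟘]          ≡⟨ ξ^-suc K [𝟘] ⟩
    ξ^ K (ξ [𝟘])            ≡⟨ cong (ξ^ K) ξ-𝟘 ⟩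
    ξ^ K (𝟘 ∷ 𝟙 ∷ [])       ≡⟨ ξ^-++ K [𝟘] (𝟙 ∷ []) ⟩
    ρ 𝟘 ++ ρ 𝟙              ≡⟨ cong (ρ 𝟘 ++_) (ρ-one {𝟙} IsOne-𝟙) ⟩
    ρ 𝟘 ++ 𝟘′ ∷ []          ∎
    where open ≡-Reasoning

  -- 0′ ∈ ξᵏ(0), ξ²(0′) = 0′1′2′ and ρ*(1′2′) = 0 · 01.
  𝟘𝟘-infix : InIterate (𝟘 ∷ 𝟘 ∷ [])
  𝟘𝟘-infix with ξ-letter-zero {𝟘′} index-fzero
  ... | o , so@(po , io) , e with ξ-view o
  ...   | zero-letter _ zo _ _ = ⊥-elim (Succ⇒¬IsZero so zo)
  ...   | top-letter _ to _ _ _ = ⊥-elim (one≢top {o} (Succ-IsZero⇒IsOne so index-fzero) to)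
  ...   | inner-letter c _ (pc , ic) e′ with ρ-nonzero-head {c} (trans ic (cong suc io))
  ...     | T , eρc , _ =
            InIterate-infix [] (𝟘 ∷ 𝟘 ∷ []) (T ++ [])
              (subst InIterate ρ*oc≡ (InIterate-ξ^ K (InIterate-infix (𝟘′ ∷ []) (o ∷ c ∷ []) [] (subst InIterate ξ²𝟘′≡ 𝟘′-infix))))
    where
    𝟘′-infix : InIterate (ξ^ 2 (𝟘′ ∷ []))
    𝟘′-infix = InIterate-ξ^ 2 (k , ρ 𝟘 , [] , ξ^k-𝟘)
    ξ²𝟘′≡ : ξ^ 2 (𝟘′ ∷ []) ≡ 𝟘′ ∷ o ∷ c ∷ []
    ξ²𝟘′≡ rewrite e | e | e′ = refl
    ρ*oc≡ : ξ^ K (o ∷ c ∷ []) ≡ 𝟘 ∷ 𝟘 ∷ T ++ []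
    ρ*oc≡ = begin
      ξ^ K (o ∷ c ∷ [])
        ≡⟨ ξ^K≡ρ* _ ⟩
      ρ o ++ ρ c ++ []
        ≡⟨ cong₂ (λ x y → x ++ y ++ []) (ρ-one {o} (Succ-IsZero⇒IsOne so index-fzero)) eρc ⟩
      (not (primed o) , fzero) ∷ (not (primed c) , fzero) ∷ T ++ []
        ≡⟨ cong₂ (λ b b′ → (not b , fzero) ∷ (not b′ , fzero) ∷ T ++ []) po (trans pc po) ⟩
      𝟘 ∷ 𝟘 ∷ T ++ []
        ∎
      where open ≡-Reasoning

  ¬IsZero⇒≢𝟘 : ∀ {c} → ¬ IsZero c → c ≢ 𝟘
  ¬IsZero⇒≢𝟘 ¬zc refl = ¬zc IsZero-𝟘

  ξ^-𝟘-shape : ∀ n → n ≤ k → ∃[ T ] (ξ^ n [𝟘] ≡ 𝟘 ∷ T × All (_≢ 𝟘) T)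
  ξ^-𝟘-shape n n≤k with m≤n⇒m<n∨m≡n n≤k
  ... | inj₁ n<k with ξ^-zero-run {𝟘} IsZero-𝟘 n n<k
  ...   | run , l with Run-from-zero false _ n run l
  ...     | T , e , nz = T , e , All.map ¬IsZero⇒≢𝟘 nz
  ξ^-𝟘-shape n n≤k | inj₂ refl with ρ-zero-head {𝟘} IsZero-𝟘
  ... | T , e , nz = T ++ 𝟘′ ∷ [] , trans ξ^k-𝟘 (cong (_++ 𝟘′ ∷ []) e) , ++⁺ (All.map ¬IsZero⇒≢𝟘 nz) ((λ ()) ∷ [])

  occurs-avoids-𝟘 : ∀ (T : Word) j ℓ → OccursAt T j → All (_≢ 𝟘) T → j ≤ ℓ → ℓ < j + length T → u ℓ ≢ 𝟘
  occurs-avoids-𝟘 []      j ℓ _        _         j≤ℓ ℓ< = ⊥-elim (<⇒≱ ℓ< (subst (_≤ ℓ) (sym (+-identityʳ j)) j≤ℓ))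
  occurs-avoids-𝟘 (c ∷ T) j ℓ (e , oc) (c≢𝟘 ∷ a) j≤ℓ ℓ< with m≤n⇒m<n∨m≡n j≤ℓ
  ... | inj₂ refl = λ uℓ → c≢𝟘 (trans (sym e) uℓ)
  ... | inj₁ j<ℓ  = occurs-avoids-𝟘 T (suc j) ℓ oc a j<ℓ (subst (ℓ <_) (+-suc j (length T)) ℓ<)

  occurrences-apart : ∀ T → All (_≢ 𝟘) T → ∀ {j ℓ} → OccursAt (𝟘 ∷ T) j → OccursAt (𝟘 ∷ T) ℓ → j < ℓ →
    j + length (𝟘 ∷ T) ≤ ℓ
  occurrences-apart T a {j} {ℓ} (_ , oj) (uℓ , _) j<ℓ with j + length (𝟘 ∷ T) ≤? ℓ
  ... | yes apart = apart
  ... | no ¬apart = ⊥-elim (occurs-avoids-𝟘 T (suc j) ℓ oj a j<ℓ (subst (ℓ <_) (+-suc j (length T)) (≰⇒> ¬apart)) uℓ)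

  shortest-return : ∀ T → All (_≢ 𝟘) T → InIterate ((𝟘 ∷ T) ++ (𝟘 ∷ T)) → ShortestReturnWord (𝟘 ∷ T) (𝟘 ∷ T)
  shortest-return T a (M , A , B , e) = (j , j + length W , m<m+n j (s≤s z≤n) , oj , oℓ , between , sym slice≡) , minimal
    where
    W : Word
    W = 𝟘 ∷ T
    j : ℕ
    j = length A
    oj : OccursAt W j
    oj = proj₁ (occurs-++⁻ W W j (InIterate-occurs M A (W ++ W) B e))
    oℓ : OccursAt W (j + length W)
    oℓ = proj₂ (occurs-++⁻ W W j (InIterate-occurs M A (W ++ W) B e))
    between : ∀ m → j < m → m < j + length W → ¬ OccursAt W m
    between m j<m m< om = <⇒≱ m< (occurrences-apart T a oj om j<m)
    slice≡ : slice j (j + length W ∸ j) ≡ W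
    slice≡ = trans (cong (slice j) (m+n∸m≡n j (length W))) (slice-occurs W j oj)
    minimal : ∀ r′ → ReturnWord W r′ → length W ≤ length r′
    minimal _ (j′ , ℓ′ , j′<ℓ′ , oj′ , oℓ′ , _ , refl) rewrite length-slice j′ (ℓ′ ∸ j′) =
      m+n≤o⇒m≤o∸n (length W) (subst (_≤ ℓ′) (+-comm j′ (length W)) (occurrences-apart T a oj′ oℓ′ j′<ℓ′))

  shortest-return-ξ^ : ∀ n → n ≤ k → ShortestReturnWord (ξ^ n [𝟘]) (ξ^ n [𝟘])
  shortest-return-ξ^ n n≤k with ξ^-𝟘-shape n n≤k
  ... | T , e , a rewrite e =
    shortest-return T a (subst InIterate (trans (ξ^-++ n [𝟘] [𝟘]) (cong₂ _++_ e e)) (InIterate-ξ^ n 𝟘𝟘-infix))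

  Succ-after-𝟘𝟙𝟘 : ∀ {y} Y → Good (𝟘 ∷ 𝟙 ∷ 𝟘 ∷ y ∷ Y) → Succ 𝟘 y
  Succ-after-𝟘𝟙𝟘 Y (_ , (_ , no100 , _) , (step , _) , _) = Succ-unless-zero step (no100 IsOne-𝟙 IsZero-𝟘)

  Succ-after-𝟘𝟙𝟘y : ∀ {y y′} Y → Good (𝟘 ∷ 𝟙 ∷ 𝟘 ∷ y ∷ y′ ∷ Y) → Succ y y′
  Succ-after-𝟘𝟙𝟘y Y g@(_ , (_ , _ , no1010 , _) , _ , (step , _) , _) =
    Succ-unless-zero step (no1010 IsOne-𝟙 IsZero-𝟘 (Succ-IsZero⇒IsOne (Succ-after-𝟘𝟙𝟘 (_ ∷ Y) g) IsZero-𝟘))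

  -- After 0 1 0 come 1 and 2, and ρ(1 2) = 0′ · 0′1′.
  after-𝟘𝟙𝟘 : ∀ Y {x S} → Good (𝟘 ∷ 𝟙 ∷ 𝟘 ∷ Y) → ρ* Y ≡ 𝟘′ ∷ x ∷ S → x ≡ 𝟘′
  after-𝟘𝟙𝟘 (y ∷ []) g e =
    ⊥-elim ([]≢∷ (∷-injectiveʳ (trans (cong (_++ []) (sym (ρ-one {y} (Succ-IsZero⇒IsOne (Succ-after-𝟘𝟙𝟘 [] g) IsZero-𝟘)))) e)))
  after-𝟘𝟙𝟘 (y ∷ y′ ∷ Y) {x} {S} g e =
    trans (sym (∷-injectiveˡ ρy′…≡)) (cong (λ b → not b , fzero) (trans (proj₁ syy′) (proj₁ s𝟘y)))
    where
    s𝟘y : Succ 𝟘 y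
    s𝟘y = Succ-after-𝟘𝟙𝟘 (y′ ∷ Y) g
    syy′ : Succ y y′
    syy′ = Succ-after-𝟘𝟙𝟘y Y g
    oy : IsOne y
    oy = Succ-IsZero⇒IsOne s𝟘y IsZero-𝟘
    ρy′ : ∃[ T ] (ρ y′ ≡ (not (primed y′) , fzero) ∷ T × All (¬_ ∘ IsZero) T)
    ρy′ = ρ-nonzero-head {y′} (trans (proj₂ syy′) (cong suc oy))
    ρy′…≡ : (not (primed y′) , fzero) ∷ proj₁ ρy′ ++ ρ* Y ≡ x ∷ S
    ρy′…≡ = trans (cong (_++ ρ* Y) (sym (proj₁ (proj₂ ρy′))))
                  (∷-injectiveʳ (trans (cong (_++ (ρ y′ ++ ρ* Y)) (sym (ρ-one {y} oy))) e))

  𝟘′-after-ρ*𝟘𝟙𝟘 : ∀ x → InIterate (ρ* (𝟘 ∷ 𝟙 ∷ 𝟘 ∷ []) ++ 𝟘′ ∷ x ∷ []) → x ≡ 𝟘′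
  𝟘′-after-ρ*𝟘𝟙𝟘 x fac =
    let Y , S , g , eY = recognise (𝟘 ∷ 𝟙 ∷ 𝟘 ∷ []) 𝟘′ (x ∷ []) fac index-fzero in after-𝟘𝟙𝟘 Y g eY

  ξ^k-𝟘²-followed-by-𝟘′ : ∀ i → OccursAt (ξ^ k [𝟘] ++ ξ^ k [𝟘]) i → u (i + 2 * length (ξ^ k [𝟘])) ≡ 𝟘′
  ξ^k-𝟘²-followed-by-𝟘′ i oc = 𝟘′-after-ρ*𝟘𝟙𝟘 x fac
    where
    w : Word
    w = ξ^ k [𝟘]
    x : Letter
    x = u (i + 2 * length w)
    |ww|≡ : i + length (w ++ w) ≡ i + 2 * length w
    |ww|≡ = cong (i +_) (trans (length-++ w) (cong (length w +_) (sym (+-identityʳ (length w)))))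
    ww≡ : (w ++ w) ++ x ∷ [] ≡ ρ* (𝟘 ∷ 𝟙 ∷ 𝟘 ∷ []) ++ 𝟘′ ∷ x ∷ []
    ww≡ = begin
      (w ++ w) ++ x ∷ []                                   ≡⟨ cong (λ v → (v ++ v) ++ x ∷ []) ξ^k-𝟘 ⟩
      ((ρ 𝟘 ++ 𝟘′ ∷ []) ++ ρ 𝟘 ++ 𝟘′ ∷ []) ++ x ∷ []       ≡⟨ ++-assoc (ρ 𝟘 ++ 𝟘′ ∷ []) _ _ ⟩
      (ρ 𝟘 ++ 𝟘′ ∷ []) ++ (ρ 𝟘 ++ 𝟘′ ∷ []) ++ x ∷ []       ≡⟨ ++-assoc (ρ 𝟘) _ _ ⟩
      ρ 𝟘 ++ 𝟘′ ∷ (ρ 𝟘 ++ 𝟘′ ∷ []) ++ x ∷ []              ≡⟨ cong (λ v → ρ 𝟘 ++ 𝟘′ ∷ v) (++-assoc (ρ 𝟘) _ _) ⟩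
      ρ 𝟘 ++ 𝟘′ ∷ ρ 𝟘 ++ 𝟘′ ∷ x ∷ []
        ≡⟨ cong (λ v → ρ 𝟘 ++ 𝟘′ ∷ (v ++ 𝟘′ ∷ x ∷ [])) (sym (++-identityʳ (ρ 𝟘))) ⟩
      ρ 𝟘 ++ 𝟘′ ∷ (ρ 𝟘 ++ []) ++ 𝟘′ ∷ x ∷ []              ≡⟨ sym (++-assoc (ρ 𝟘) _ _) ⟩
      (ρ 𝟘 ++ 𝟘′ ∷ ρ 𝟘 ++ []) ++ 𝟘′ ∷ x ∷ []
        ≡⟨ cong (λ v → (ρ 𝟘 ++ v ++ ρ 𝟘 ++ []) ++ 𝟘′ ∷ x ∷ []) (sym (ρ-one {𝟙} IsOne-𝟙)) ⟩
      ρ* (𝟘 ∷ 𝟙 ∷ 𝟘 ∷ []) ++ 𝟘′ ∷ x ∷ []                   ∎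
      where open ≡-Reasoning
    fac : InIterate (ρ* (𝟘 ∷ 𝟙 ∷ 𝟘 ∷ []) ++ 𝟘′ ∷ x ∷ [])
    fac = subst InIterate ww≡ (Factor⇒InIterate (i , occurs-++⁺ (w ++ w) (x ∷ []) i oc (cong u |ww|≡ , tt)))

lemma1 : ∀ (k : ℕ) (hk : 4 ≤ k) → let open Setup k hk in
    (∀ (n : ℕ) → 1 ≤ n → n ≢ k →
      SyncPoint [] (ξ^ n (𝟘 ∷ [])) × SyncPoint (ξ^ n (𝟘 ∷ [])) [])
    × (∀ (n : ℕ) → n ≤ k → ShortestReturnWord (ξ^ n (𝟘 ∷ [])) (ξ^ n (𝟘 ∷ [])))
    × (∀ (i : ℕ) → OccursAt (ξ^ k (𝟘 ∷ []) ++ ξ^ k (𝟘 ∷ [])) i →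
      u (i + 2 * length (ξ^ k (𝟘 ∷ []))) ≡ 𝟘′)
lemma1 k hk = (λ n 1≤n n≢k → sync-start n , sync-end n 1≤n n≢k) , shortest-return-ξ^ , ξ^k-𝟘²-followed-by-𝟘′
  where open Proof k hk
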